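{- IKC(no-mod) satisfies the Richness, Inter-edge Consistency and Fixed Point axioms, but violates the Standard Consistency, Refinement Consistency, Connectivity and Pair-of-Cliques axioms.
   Context: A network is a finite simple undirected unweighted graph $N=(V,E)$; a clustering is a partition of $V$ into nonempty clusters; $N[S]$ is the induced subgraph on $S\subseteq V$. For an integer $k\ge0$, the $k$-core of a graph $H$ is the subgraph obtained by repeatedly deleting vertices of degree less than $k$ (in the current subgraph) until none remain, i.e. the maximal induced subgraph of minimum degree at least $k$ (possibly empty). IKC(no-mod): on input $N=(V,E)$, set $R=V$; while $R\neq\emptyset$: let $k$ be the largest integer such that the $k$-core of $N[R]$ is nonempty; output the vertex set of each connected component of this $k$-core as a cluster, and remove these vertices from $R$. It is deterministic; write $M(N)$ for its output. Axioms for a deterministic method $M$: Richness: for every finite $V$ and every partition $\Gamma$ of $V$ (including $\{V\}$) there is $E$ with $M((V,E))=\Gamma$. Standard Consistency: whenever $E'$ is obtained from $E$ by deleting some edges between different clusters of $M(N)$ and/or adding some edges with both endpoints in a common cluster of $M(N)$, $M((V,E'))=M(N)$. Refinement Consistency: for such $E'$, every cluster of $M((V,E'))$ is contained in a cluster of $M(N)$. Inter-edge Consistency: whenever $E'$ is obtained from $E$ by only deleting edges between different clusters of $M(N)$, $M((V,E'))=M(N)$. Connectivity: there is a non-negative non-decreasing $f:\mathbb{R}^+\to\mathbb{R}^+$ with $f(x)\to\infty$ such that for every $N$ and every $c\in M(N)$ with $|c|\ge 2$, the minimum number of edges of $N[c]$ whose removal disconnects $N[c]$ is strictly greater than $f(|c|)$.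 Pair-of-Cliques: a pair-of-cliques component is a connected component with vertex set $A\cup B$, $A\cap B=\emptyset$, $|A|=|B|=n$, $A,B$ cliques, exactly one edge between $A$ and $B$; size $2n$. The axiom holds if there is $n_0$ such that for every $N$ and every pair-of-cliques component of size $\ge n_0$, $A$ and $B$ are clusters of $M(N)$. Fixed Point: for every $N$ and every nonempty $\mathcal{D}\subseteq M(N)$, $M(N[\bigcup\mathcal{D}])=\mathcal{D}$. -}

module Defs where

open import Data.Bool using (Bool; true; false; _∧_; _∨_; not; if_then_else_)
open import Data.Bool.Properties using (∧-comm)
open import Data.Nat using (ℕ; zero; suc; _+_; _≤_; _<_; _≤ᵇ_; _<ᵇ_)
open import Data.Fin using (Fin; toℕ) renaming (zero to fzero; suc to fsuc)
open import Data.Product using (Σ; ∃; _×_; _,_; proj₁)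
open import Function using (_∘_)
open import Function.Bundles using (_⇔_)
open import Relation.Binary.PropositionalEquality using (_≡_; _≢_; refl; cong; trans)
open import Relation.Nullary using (¬_)

-- A finite vertex set V is represented as a subset of Fin n
-- (every finite set is in bijection with such a subset; this makes
-- induced subgraphs N[S] again networks of the same kind).

record Network (n : ℕ) : Set where
  field
    V     : Fin n → Bool
    adj   : Fin n → Fin n → Bool
    symm  : ∀ x y → adj x y ≡ adj y x
    loopless : ∀ x → adj x x ≡ false
    inV   : ∀ x y → adj x y ≡ true → V x ≡ true
open Network public

count : ∀ {n} → (Fin n → Bool) → ℕ
count {zero}  P = 0
count {suc n} P = (if P fzero then 1 else 0) + count (P ∘ fsuc)

edgeCount : ∀ {n} → (Fin n → Fin n → Bool) → ℕ
edgeCount {zero}  F = 0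
edgeCount {suc n} F =
  count (λ y → (toℕ (fzero {n}) <ᵇ toℕ y) ∧ F fzero y)
  + edgeCount (λ x y → F (fsuc x) (fsuc y))

data ReachIn {n} (a : Fin n → Fin n → Bool) (S : Fin n → Bool) (x : Fin n)
     : Fin n → Set where
  here : S x ≡ true → ReachIn a S x x
  step : ∀ {y z} → ReachIn a S x y → a y z ≡ true → S z ≡ true → ReachIn a S x z

module _ {n : ℕ} (N : Network n) where

  deg : (Fin n → Bool) → Fin n → ℕ
  deg S x = count (λ y → S y ∧ adj N x y)

  peel : ℕ → (Fin n → Bool) → (Fin n → Bool)
  peel k S x = S x ∧ (k ≤ᵇ deg S x)

  iterate : ℕ → ℕ → (Fin n → Bool) → (Fin n → Bool)
  iterate zero    k S = S
  iterate (suc i) k S = iterate i k (peel k S)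

  -- the k-core of N[S]: repeated deletion; n rounds suffice since each
  -- non-stationary round deletes at least one of the ≤ n vertices
  core : ℕ → (Fin n → Bool) → (Fin n → Bool)
  core k S = iterate n k S

  nonempty : ∀ {m} → (Fin m → Bool) → Bool
  nonempty {zero}  P = false
  nonempty {suc m} P = P fzero ∨ nonempty (P ∘ fsuc)

  maxKFrom : ℕ → (Fin n → Bool) → ℕ
  maxKFrom zero    S = 0
  maxKFrom (suc k) S = if nonempty (core (suc k) S) then suc k else maxKFrom k S

  -- all degrees are < n, so the largest k with nonempty k-core is ≤ n
  maxK : (Fin n → Bool) → ℕ
  maxK S = maxKFrom n S

  roundCore : (Fin n → Bool) → (Fin n → Bool)
  roundCore R = core (maxK R) R

  remaining : ℕ → (Fin n → Bool)
  remaining zero    = V N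
  remaining (suc r) = λ x → remaining r x ∧ not (roundCore (remaining r) x)

  coreAt : ℕ → (Fin n → Bool)
  coreAt r = roundCore (remaining r)

-- IKC(no-mod) output as "same cluster" relation: x and y lie in the same
-- connected component of the core removed in some round r.
IKC : ∀ {n} → Network n → Fin n → Fin n → Set
IKC N x y = Σ ℕ λ r → ReachIn (adj N) (coreAt N r) x y

Method : Set₁
Method = ∀ {n} → Network n → Fin n → Fin n → Set

SameClustering : ∀ {n} → (Fin n → Fin n → Set) → (Fin n → Fin n → Set) → Set
SameClustering P Q = ∀ x y → P x y ⇔ Q x y

IsCluster : Method → ∀ {n} → Network n → (Fin n → Bool) → Set
IsCluster M {n} N A = Σ (Fin n) λ x → V N x ≡ true × (∀ y → (A y ≡ true) ⇔ M N x y)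

induced : ∀ {n} → Network n → (Fin n → Bool) → Network n
induced N U = record
  { V = U
  ; adj = λ x y → adj N x y ∧ (U x ∧ U y)
  ; symm = λ x y → trans (cong (_∧ (U x ∧ U y)) (symm N x y))
                         (cong (adj N y x ∧_) (∧-comm (U x) (U y)))
  ; loopless = λ x → lem (adj N x x) (loopless N x)
  ; inV = λ x y e → proj₁ (∧-true (U x) (U y) (proj₂' (adj N x y) e))
  }
  where
  lem : ∀ b {c} → b ≡ false → b ∧ c ≡ false
  lem false refl = refl
  proj₂' : ∀ b {c} → b ∧ c ≡ true → c ≡ true
  proj₂' true e = e
  ∧-true : ∀ b c → b ∧ c ≡ true → b ≡ true × c ≡ true
  ∧-true true true refl = refl , refl

Richness : Method → Set
Richness M = ∀ n (W : Fin n → Bool) (label : Fin n → ℕ) →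
  Σ (Network n) λ N → (∀ x → V N x ≡ W x) ×
    SameClustering (M N) (λ x y → W x ≡ true × W y ≡ true × label x ≡ label y)

ConsistentChange : Method → ∀ {n} → Network n → Network n → Set
ConsistentChange M N N' =
  (∀ x → V N' x ≡ V N x) ×
  (∀ x y → adj N x y ≡ true → adj N' x y ≡ false → ¬ M N x y) ×
  (∀ x y → adj N x y ≡ false → adj N' x y ≡ true → M N x y)

InterEdgeChange : Method → ∀ {n} → Network n → Network n → Set
InterEdgeChange M N N' =
  (∀ x → V N' x ≡ V N x) ×
  (∀ x y → adj N' x y ≡ true → adj N x y ≡ true) ×
  (∀ x y → adj N x y ≡ true → adj N' x y ≡ false → ¬ M N x y)

StandardConsistency : Method → Set
StandardConsistency M = ∀ {n} (N N' : Network n) →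
  ConsistentChange M N N' → SameClustering (M N') (M N)

RefinementConsistency : Method → Set
RefinementConsistency M = ∀ {n} (N N' : Network n) →
  ConsistentChange M N N' → ∀ x y → M N' x y → M N x y

InterEdgeConsistency : Method → Set
InterEdgeConsistency M = ∀ {n} (N N' : Network n) →
  InterEdgeChange M N N' → SameClustering (M N') (M N)

DisconnectingSet : ∀ {n} → Network n → (Fin n → Bool) → (Fin n → Fin n → Bool) → Set
DisconnectingSet N c F =
  (∀ x y → F x y ≡ F y x) ×
  (∀ x y → F x y ≡ true → adj N x y ≡ true × c x ≡ true × c y ≡ true) ×
  Σ _ λ x → Σ _ λ y → c x ≡ true × c y ≡ true ×
    ¬ ReachIn (λ u v → adj N u v ∧ not (F u v)) c x y

-- f : ℝ⁺ → ℝ⁺ is only ever compared with integer cut sizes at integer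
-- arguments, so an ℕ → ℕ function (⌊f⌋ restricted to ℕ) is equivalent.
Connectivity : Method → Set
Connectivity M = Σ (ℕ → ℕ) λ f →
  (∀ a b → a ≤ b → f a ≤ f b) ×
  (∀ B → Σ ℕ λ m → B ≤ f m) ×
  (∀ {n} (N : Network n) (x : Fin n) (c : Fin n → Bool) →
     V N x ≡ true → (∀ y → (c y ≡ true) ⇔ M N x y) → 2 ≤ count c →
     ∀ F → DisconnectingSet N c F → f (count c) < edgeCount F)

IsComponent : ∀ {n} → Network n → (Fin n → Bool) → Set
IsComponent N S =
  (∀ x → S x ≡ true → V N x ≡ true) ×
  (Σ _ λ x → S x ≡ true) ×
  (∀ x y → S x ≡ true → adj N x y ≡ true → S y ≡ true) ×
  (∀ x y → S x ≡ true → S y ≡ true → ReachIn (adj N) S x y)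

IsClique : ∀ {n} → Network n → (Fin n → Bool) → Set
IsClique N A = ∀ x y → A x ≡ true → A y ≡ true → x ≢ y → adj N x y ≡ true

PairOfCliquesComponent : ∀ {n} → Network n → (Fin n → Bool) → (Fin n → Bool) → Set
PairOfCliquesComponent N A B =
  IsComponent N (λ x → A x ∨ B x) ×
  (∀ x → A x ∧ B x ≡ false) ×
  count A ≡ count B ×
  IsClique N A × IsClique N B ×
  (Σ _ λ a → Σ _ λ b → A a ≡ true × B b ≡ true × adj N a b ≡ true ×
     (∀ a' b' → A a' ≡ true → B b' ≡ true → adj N a' b' ≡ true → a' ≡ a × b' ≡ b))

PairOfCliques : Method → Set
PairOfCliques M = Σ ℕ λ n₀ → ∀ {n} (N : Network n) (A B : Fin n → Bool) →
  PairOfCliquesComponent N A B → n₀ ≤ count A + count B →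
  IsCluster M N A × IsCluster M N B

-- D ⊆ M(N) nonempty is given by its union U: a nonempty subset of V
-- that is a union of clusters (closed under the same-cluster relation)
FixedPoint : Method → Set
FixedPoint M = ∀ {n} (N : Network n) (U : Fin n → Bool) →
  (∀ x → U x ≡ true → V N x ≡ true) →
  (Σ _ λ x → U x ≡ true) →
  (∀ x y → U x ≡ true → M N x y → U y ≡ true) →
  SameClustering (M (induced N U)) (λ x y → U x ≡ true × M N x y)

-- Each round of IKC depends only on the set R of vertices not yet clustered and on the edges
-- inside the top core of N[R]. If N' keeps exactly a union U of clusters of N, together with
-- every edge inside those clusters, then each round of N that meets U is reproduced by a round
-- of N', intersected with U, and the other rounds are skipped; with U = V this is Inter-edge
-- Consistency, and with N' = N[U] it is the Fixed Point property. For Richness, put a clique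
-- on each label class: a label class meeting the top core of a round lies entirely inside it.
--
-- The negative results come from two (q+1)-cliques joined by a single edge. Every vertex has
-- degree at least q, while only the two ends of the joining edge have degree q + 1, so the
-- (q+1)-core is empty and IKC returns the whole network as one cluster: the two cliques are not
-- clusters, and deleting one edge disconnects the cluster. For q = 2, removing an edge from the
-- second triangle pushes it into a later round; adding that intra-cluster edge back merges the
-- two clusters, against Standard and Refinement Consistency.

module Submission where

open import Defs

open import Data.Bool using (Bool; true; false; _∧_; _∨_; not; if_then_else_)
open import Data.Bool.Properties
  using (T-≡; ∧-comm; ∨-comm; ∧-identityʳ; ∨-identityʳ; ∧-zeroʳ; ∧-inverseʳ; ∨-inverseʳ; ¬-not; not-injective)
  renaming (_≟_ to _≟ᵇ_)
open import Data.Nat using (ℕ; zero; suc; _+_; _∸_; _≤_; _<_; _≤ᵇ_; _<ᵇ_; _≡ᵇ_; z≤n; s≤s)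
open import Data.Nat.Properties hiding (_≟_)
open import Data.Fin using (Fin; toℕ; fromℕ; _↑ˡ_; _↑ʳ_; #_; _≟_) renaming (zero to fzero; suc to fsuc)
open import Data.Fin.Properties using (toℕ-injective; any?; all?; toℕ-fromℕ; toℕ-↑ˡ; toℕ-↑ʳ)
  renaming (suc-injective to fsuc-injective)
open import Data.Product using (_×_; ∃; _,_; proj₁; proj₂)
open import Data.Sum using (_⊎_; inj₁; inj₂; [_,_]′)
open import Data.Empty using (⊥-elim)
open import Function using (_∘_)
open import Function.Bundles using (_⇔_; mk⇔; Equivalence)
open import Relation.Binary.PropositionalEquality
open import Relation.Binary.Definitions using (tri<; tri≈; tri>)
open import Relation.Nullary using (¬_; yes; no)
open import Relation.Nullary.Decidable using (toWitness)

∧-trueˡ : ∀ a {b} → a ∧ b ≡ true → a ≡ true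
∧-trueˡ true _ = refl

∧-trueʳ : ∀ a {b} → a ∧ b ≡ true → b ≡ true
∧-trueʳ true p = p

∧-true : ∀ {a b} → a ≡ true → b ≡ true → a ∧ b ≡ true
∧-true refl refl = refl

∨-true : ∀ a {b} → a ∨ b ≡ true → a ≡ true ⊎ b ≡ true
∨-true true _ = inj₁ refl
∨-true false p = inj₂ p

∨-trueˡ : ∀ {a b} → a ≡ true → a ∨ b ≡ true
∨-trueˡ refl = refl

∨-trueʳ : ∀ a {b} → b ≡ true → a ∨ b ≡ true
∨-trueʳ true  _ = refl
∨-trueʳ false p = p

true≢false : true ≢ false
true≢false ()

≤ᵇ≡true⇒≤ : ∀ {m n} → (m ≤ᵇ n) ≡ true → m ≤ n
≤ᵇ≡true⇒≤ {m} {n} p = ≤ᵇ⇒≤ m n (Equivalence.from T-≡ p)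

≤⇒≤ᵇ≡true : ∀ {m n} → m ≤ n → (m ≤ᵇ n) ≡ true
≤⇒≤ᵇ≡true p = Equivalence.to T-≡ (≤⇒≤ᵇ p)

<ᵇ≡true⇒< : ∀ {m n} → (m <ᵇ n) ≡ true → m < n
<ᵇ≡true⇒< {m} {n} p = <ᵇ⇒< m n (Equivalence.from T-≡ p)

<⇒<ᵇ≡true : ∀ {m n} → m < n → (m <ᵇ n) ≡ true
<⇒<ᵇ≡true p = Equivalence.to T-≡ (<⇒<ᵇ p)

≡ᵇ≡true⇒≡ : ∀ {m n} → (m ≡ᵇ n) ≡ true → m ≡ n
≡ᵇ≡true⇒≡ {m} {n} p = ≡ᵇ⇒≡ m n (Equivalence.from T-≡ p)

≡⇒≡ᵇ≡true : ∀ {m n} → m ≡ n → (m ≡ᵇ n) ≡ true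
≡⇒≡ᵇ≡true {m} {n} p = Equivalence.to T-≡ (≡⇒≡ᵇ m n p)

infix 7 _==_
_==_ : ∀ {n} → Fin n → Fin n → Bool
x == y = toℕ x ≡ᵇ toℕ y

==⇒≡ : ∀ {n} {x y : Fin n} → x == y ≡ true → x ≡ y
==⇒≡ p = toℕ-injective (≡ᵇ≡true⇒≡ p)

==-refl : ∀ {n} (x : Fin n) → x == x ≡ true
==-refl x = ≡⇒≡ᵇ≡true {toℕ x} refl

≢⇒==-false : ∀ {n} {x y : Fin n} → x ≢ y → x == y ≡ false
≢⇒==-false x≢y = ¬-not (x≢y ∘ ==⇒≡)

≡ᵇ-sym : ∀ m n → (m ≡ᵇ n) ≡ (n ≡ᵇ m)
≡ᵇ-sym zero    zero    = refl
≡ᵇ-sym zero    (suc n) = refl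
≡ᵇ-sym (suc m) zero    = refl
≡ᵇ-sym (suc m) (suc n) = ≡ᵇ-sym m n

==-sym : ∀ {n} (x y : Fin n) → x == y ≡ y == x
==-sym x y = ≡ᵇ-sym (toℕ x) (toℕ y)

not-==⇒≢ : ∀ {n} {x y : Fin n} → not (x == y) ≡ true → x ≢ y
not-==⇒≢ {x = x} p refl = true≢false (trans (sym p) (cong not (==-refl x)))

Set⟨_⟩ : ℕ → Set
Set⟨ n ⟩ = Fin n → Bool

infix 4 _⊆_ _≐_
_⊆_ : ∀ {n} → Set⟨ n ⟩ → Set⟨ n ⟩ → Set
S ⊆ T = ∀ x → S x ≡ true → T x ≡ true

_≐_ : ∀ {n} → Set⟨ n ⟩ → Set⟨ n ⟩ → Set
S ≐ T = ∀ x → S x ≡ T x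

≐⇒⊆ : ∀ {n} {S T : Set⟨ n ⟩} → S ≐ T → S ⊆ T
≐⇒⊆ S≐T x p = trans (sym (S≐T x)) p

⊆-antisym : ∀ {n} {S T : Set⟨ n ⟩} → S ⊆ T → T ⊆ S → S ≐ T
⊆-antisym {S = S} {T} S⊆T T⊆S x with S x in p | T x in q
... | true  | true  = refl
... | false | false = refl
... | true  | false = sym (trans (sym q) (S⊆T x p))
... | false | true  = trans (sym p) (T⊆S x q)

search : ∀ {n} (P : Set⟨ n ⟩) → (∃ λ x → P x ≡ true) ⊎ (∀ x → P x ≡ false)
search P with any? (λ x → P x ≟ᵇ true)
... | yes found = inj₁ found
... | no none   = inj₂ (λ x → ¬-not (λ p → none (x , p)))

private
  ind : Bool → ℕ
  ind b = if b then 1 else 0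

  ind-mono : ∀ a b → (a ≡ true → b ≡ true) → ind a ≤ ind b
  ind-mono false b _ = z≤n
  ind-mono true  b f rewrite f refl = ≤-refl

count-mono : ∀ {n} {P Q : Set⟨ n ⟩} → P ⊆ Q → count P ≤ count Q
count-mono {zero}          _   = z≤n
count-mono {suc n} {P} {Q} P⊆Q =
  +-mono-≤ (ind-mono (P fzero) (Q fzero) (P⊆Q fzero)) (count-mono (P⊆Q ∘ fsuc))

count-cong : ∀ {n} {P Q : Set⟨ n ⟩} → P ≐ Q → count P ≡ count Q
count-cong P≐Q = ≤-antisym (count-mono (≐⇒⊆ P≐Q)) (count-mono (≐⇒⊆ (sym ∘ P≐Q)))

count-≡0 : ∀ {n} {P : Set⟨ n ⟩} → (∀ x → P x ≡ false) → count P ≡ 0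
count-≡0 {zero}        _    = refl
count-≡0 {suc n} {P} empty rewrite empty fzero = count-≡0 (empty ∘ fsuc)

count≡0⇒empty : ∀ {n} {P : Set⟨ n ⟩} → count P ≡ 0 → ∀ x → P x ≡ false
count≡0⇒empty {suc n} {P} c x with P fzero in p
count≡0⇒empty {suc n} {P} c fzero    | false = p
count≡0⇒empty {suc n} {P} c (fsuc x) | false = count≡0⇒empty {P = P ∘ fsuc} c x

count≤n : ∀ {n} (P : Set⟨ n ⟩) → count P ≤ n
count≤n {zero}  P = z≤n
count≤n {suc n} P with P fzero
... | true  = s≤s (count≤n (P ∘ fsuc))
... | false = m≤n⇒m≤1+n (count≤n (P ∘ fsuc))

count-strict : ∀ {n} {P Q : Set⟨ n ⟩} → P ⊆ Q → ∀ x → Q x ≡ true → P x ≡ false →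
               count P < count Q
count-strict {suc n} {P} {Q} P⊆Q fzero q p rewrite q | p = s≤s (count-mono (P⊆Q ∘ fsuc))
count-strict {suc n} {P} {Q} P⊆Q (fsuc x) q p =
  +-mono-≤-< (ind-mono (P fzero) (Q fzero) (P⊆Q fzero)) (count-strict (P⊆Q ∘ fsuc) x q p)

count-remove : ∀ {n} (P : Set⟨ n ⟩) x → P x ≡ true →
               suc (count (λ y → P y ∧ not (y == x))) ≡ count P
count-remove {suc n} P fzero p rewrite p =
  cong suc (count-cong (λ y → ∧-identityʳ (P (fsuc y))))
count-remove {suc n} P (fsuc x) p
  rewrite ∧-identityʳ (P fzero)
        | sym (count-remove (P ∘ fsuc) x p) = sym (+-suc (ind (P fzero)) _)

count-≤1 : ∀ {n} (P : Set⟨ n ⟩) → (∀ x y → P x ≡ true → P y ≡ true → x ≡ y) → count P ≤ 1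
count-≤1 {zero}  P _ = z≤n
count-≤1 {suc n} P unique with P fzero in p
... | true  rewrite count-≡0 {P = P ∘ fsuc} (λ x → ¬-not (λ q → 0≢1+n (cong toℕ (unique fzero (fsuc x) p q))))
      = ≤-refl
... | false = count-≤1 (P ∘ fsuc) (λ x y p q → fsuc-injective (unique (fsuc x) (fsuc y) p q))

count-<ᵇ : ∀ {n} k → k ≤ n → count {n} (λ x → toℕ x <ᵇ k) ≡ k
count-<ᵇ {n} zero _         = count-≡0 {n} {P = λ x → toℕ x <ᵇ 0} (λ _ → refl)
count-<ᵇ (suc k) (s≤s k≤n) = cong suc (count-<ᵇ k k≤n)

count-full : ∀ {n} → count {n} (λ _ → true) ≡ n
count-full {zero}  = refl
count-full {suc n} = cong suc count-full

count-+-count-not : ∀ {n} (P : Set⟨ n ⟩) → count P + count (not ∘ P) ≡ n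
count-+-count-not {zero}  P = refl
count-+-count-not {suc n} P with P fzero
... | true  = cong suc (count-+-count-not (P ∘ fsuc))
... | false = trans (+-suc _ _) (cong suc (count-+-count-not (P ∘ fsuc)))

-- k-cores

infix 4 _⊆ᴱ_
_⊆ᴱ_ : ∀ {n} → Network n → Network n → Set
N' ⊆ᴱ N = ∀ x y → adj N' x y ≡ true → adj N x y ≡ true

module _ {n : ℕ} where

  deg-mono : ∀ (N' N : Network n) {S' S : Set⟨ n ⟩} → N' ⊆ᴱ N → S' ⊆ S →
             ∀ x → deg N' S' x ≤ deg N S x
  deg-mono N' N {S'} N'⊆N S'⊆S x =
    count-mono (λ y p → ∧-true (S'⊆S y (∧-trueˡ (S' y) p)) (N'⊆N x y (∧-trueʳ (S' y) p)))

  peel-mono : ∀ (N' N : Network n) → N' ⊆ᴱ N → ∀ {k k'} → k ≤ k' → {S' S : Set⟨ n ⟩} → S' ⊆ S →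
              peel N' k' S' ⊆ peel N k S
  peel-mono N' N N'⊆N k≤k' {S'} S'⊆S x p = ∧-true (S'⊆S x (∧-trueˡ (S' x) p))
    (≤⇒≤ᵇ≡true (≤-trans k≤k' (≤-trans (≤ᵇ≡true⇒≤ (∧-trueʳ (S' x) p)) (deg-mono N' N N'⊆N S'⊆S x))))

  core-mono : ∀ (N' N : Network n) → N' ⊆ᴱ N → ∀ {k k'} → k ≤ k' → {S' S : Set⟨ n ⟩} → S' ⊆ S →
              core N' k' S' ⊆ core N k S
  core-mono N' N N'⊆N {k} {k'} k≤k' = go n
    where
    go : ∀ i {S' S} → S' ⊆ S → iterate N' i k' S' ⊆ iterate N i k S
    go zero    S'⊆S = S'⊆S
    go (suc i) S'⊆S = go i (peel-mono N' N N'⊆N k≤k' S'⊆S)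

  module _ (N : Network n) where

    peel-⊆ : ∀ k S → peel N k S ⊆ S
    peel-⊆ k S x p = ∧-trueˡ (S x) p

    iterate-⊆ : ∀ i k S → iterate N i k S ⊆ S
    iterate-⊆ zero    k S x p = p
    iterate-⊆ (suc i) k S x p = peel-⊆ k S x (iterate-⊆ i k (peel N k S) x p)

    core-⊆ : ∀ k S → core N k S ⊆ S
    core-⊆ = iterate-⊆ n

    peel-cong : ∀ k {S T} → S ≐ T → peel N k S ≐ peel N k T
    peel-cong k S≐T x =
      cong₂ (λ a d → a ∧ (k ≤ᵇ d)) (S≐T x) (count-cong (λ y → cong (_∧ adj N x y) (S≐T y)))

    core-cong : ∀ k {S T} → S ≐ T → core N k S ≐ core N k T
    core-cong k = go n
      where
      go : ∀ i {S T} → S ≐ T → iterate N i k S ≐ iterate N i k T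
      go zero    S≐T = S≐T
      go (suc i) S≐T = go i (peel-cong k S≐T)

    iterate-suc : ∀ i k S → iterate N (suc i) k S ≡ peel N k (iterate N i k S)
    iterate-suc zero    k S = refl
    iterate-suc (suc i) k S = iterate-suc i k (peel N k S)

    peel-fixed-or-shrinks : ∀ k S → peel N k S ≐ S ⊎ count (peel N k S) < count S
    peel-fixed-or-shrinks k S with search (λ x → S x ∧ not (k ≤ᵇ deg N S x))
    ... | inj₁ (x , p) = inj₂ (count-strict (peel-⊆ k S) x (∧-trueˡ (S x) p) (dropped (S x) _ p))
      where
      dropped : ∀ a b → a ∧ not b ≡ true → a ∧ b ≡ false
      dropped true false _ = refl
    ... | inj₂ none = inj₁ (λ x → kept (S x) _ (none x))
      where
      kept : ∀ a b → a ∧ not b ≡ false → a ∧ b ≡ a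
      kept true  true  _ = refl
      kept false b     _ = refl

    -- n rounds of peeling suffice: until the fixed point, each round removes a vertex.
    iterate-fixed-or-small : ∀ k S i →
      peel N k (iterate N i k S) ≐ iterate N i k S ⊎ count (iterate N i k S) + i ≤ n
    iterate-fixed-or-small k S zero = inj₂ (≤-trans (≤-reflexive (+-identityʳ _)) (count≤n S))
    iterate-fixed-or-small k S (suc i) rewrite iterate-suc i k S
      with iterate-fixed-or-small k S i
    ... | inj₁ fixed = inj₁ (peel-cong k fixed)
    ... | inj₂ small with peel-fixed-or-shrinks k (iterate N i k S)
    ...   | inj₁ fixed   = inj₁ (peel-cong k fixed)
    ...   | inj₂ shrinks = inj₂ (≤-trans (≤-reflexive (+-suc _ i)) (≤-trans (+-monoˡ-≤ i shrinks) small))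

    core-fixed : ∀ k S → peel N k (core N k S) ≐ core N k S
    core-fixed k S with iterate-fixed-or-small k S n
    ... | inj₁ fixed = fixed
    ... | inj₂ small = ⊆-antisym (peel-⊆ k _) (λ x p → ⊥-elim (true≢false (trans (sym p) (empty x))))
      where
      empty : ∀ x → core N k S x ≡ false
      empty = count≡0⇒empty (n≤0⇒n≡0 (+-cancelʳ-≤ _ _ 0 small))

    core-deg : ∀ k S x → core N k S x ≡ true → k ≤ deg N (core N k S) x
    core-deg k S x p = ≤ᵇ≡true⇒≤ (∧-trueʳ (core N k S x) (trans (core-fixed k S x) p))

    core-maximal : ∀ k {T S} → T ⊆ S → (∀ x → T x ≡ true → k ≤ deg N T x) → T ⊆ core N k S
    core-maximal k {T} T⊆S T-deg = go n T⊆S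
      where
      T⊆peel-T : T ⊆ peel N k T
      T⊆peel-T x t = ∧-true t (≤⇒≤ᵇ≡true (T-deg x t))
      go : ∀ i {S} → T ⊆ S → T ⊆ iterate N i k S
      go zero    T⊆S = T⊆S
      go (suc i) T⊆S = go i (λ x t → peel-mono N N (λ _ _ e → e) {k} ≤-refl T⊆S x (T⊆peel-T x t))

module _ {n : ℕ} (N : Network n) where

  nonempty-intro : ∀ {m} (P : Set⟨ m ⟩) x → P x ≡ true → nonempty N P ≡ true
  nonempty-intro P fzero    p rewrite p = refl
  nonempty-intro P (fsuc x) p with P fzero
  ... | true  = refl
  ... | false = nonempty-intro (P ∘ fsuc) x p

  nonempty-elim : ∀ {m} (P : Set⟨ m ⟩) → nonempty N P ≡ true → ∃ λ x → P x ≡ true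
  nonempty-elim {suc m} P ne with P fzero in p
  ... | true  = fzero , p
  ... | false = let x , q = nonempty-elim (P ∘ fsuc) ne in fsuc x , q

  nonempty-false : ∀ {m} (P : Set⟨ m ⟩) → (∀ x → P x ≡ false) → nonempty N P ≡ false
  nonempty-false P empty = ¬-not λ ne →
    let x , p = nonempty-elim P ne in true≢false (trans (sym p) (empty x))

  IsMaxCoreUpTo : ℕ → Set⟨ n ⟩ → ℕ → Set
  IsMaxCoreUpTo b S k = k ≤ b × (k ≡ 0 ⊎ nonempty N (core N k S) ≡ true) ×
                        (∀ j → k < j → j ≤ b → nonempty N (core N j S) ≡ false)

  maxKFrom-spec : ∀ b S → IsMaxCoreUpTo b S (maxKFrom N b S)
  maxKFrom-spec zero    S = z≤n , inj₁ refl , λ j k<j j≤0 → ⊥-elim (<-irrefl refl (<-≤-trans k<j j≤0))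
  maxKFrom-spec (suc b) S with nonempty N (core N (suc b) S) in ne
  ... | true  = ≤-refl , inj₂ ne , λ j k<j j≤b → ⊥-elim (<-irrefl refl (<-≤-trans k<j j≤b))
  ... | false with maxKFrom-spec b S
  ...   | k≤b , k-ok , above = m≤n⇒m≤1+n k≤b , k-ok , above'
    where
    above' : ∀ j → maxKFrom N b S < j → j ≤ suc b → nonempty N (core N j S) ≡ false
    above' j k<j j≤1+b with m≤n⇒m<n∨m≡n j≤1+b
    ... | inj₁ (s≤s j≤b) = above j k<j j≤b
    ... | inj₂ refl      = ne

  maxKFrom-unique : ∀ b S k → IsMaxCoreUpTo b S k → maxKFrom N b S ≡ k
  maxKFrom-unique zero    S k (k≤0 , _) = sym (n≤0⇒n≡0 k≤0)
  maxKFrom-unique (suc b) S k (k≤1+b , k-ok , above) with nonempty N (core N (suc b) S) in ne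
                                                         | m≤n⇒m<n∨m≡n k≤1+b
  ... | true  | inj₁ k<1+b = ⊥-elim (true≢false (trans (sym ne) (above (suc b) k<1+b ≤-refl)))
  ... | true  | inj₂ k≡1+b = sym k≡1+b
  ... | false | inj₁ (s≤s k≤b) = maxKFrom-unique b S k (k≤b , k-ok , λ j k<j j≤b → above j k<j (m≤n⇒m≤1+n j≤b))
  ... | false | inj₂ refl with k-ok
  ...   | inj₂ ne' = ⊥-elim (true≢false (trans (sym ne') ne))

  nonempty-cong : ∀ {m} {P Q : Set⟨ m ⟩} → P ≐ Q → nonempty N P ≡ nonempty N Q
  nonempty-cong {zero}  _   = refl
  nonempty-cong {suc m} P≐Q = cong₂ _∨_ (P≐Q fzero) (nonempty-cong (P≐Q ∘ fsuc))

  maxKFrom-cong : ∀ b {S T} → S ≐ T → maxKFrom N b S ≡ maxKFrom N b T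
  maxKFrom-cong zero    _   = refl
  maxKFrom-cong (suc b) S≐T rewrite nonempty-cong (core-cong N (suc b) S≐T) | maxKFrom-cong b S≐T = refl

  roundCore-cong : ∀ {S T} → S ≐ T → roundCore N S ≐ roundCore N T
  roundCore-cong {S} {T} S≐T x rewrite maxKFrom-cong n S≐T = core-cong N (maxK N T) S≐T x

  roundCore-nonempty : ∀ S x → S x ≡ true → ∃ λ y → roundCore N S y ≡ true
  roundCore-nonempty S x p with maxKFrom-spec n S
  ... | _ , inj₂ ne , _ = nonempty-elim _ ne
  ... | _ , inj₁ k≡0 , _ rewrite k≡0 = x , core-maximal N 0 (λ _ q → q) (λ _ _ → z≤n) x p

  core-above-maxK : ∀ S x → core N (suc (maxK N S)) S x ≡ false
  core-above-maxK S x with maxKFrom-spec n S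
  ... | k≤n , _ , above with m≤n⇒m<n∨m≡n k≤n
  ...   | inj₁ k<n = ¬-not λ p → true≢false (trans (sym (nonempty-intro _ x p)) (above _ ≤-refl k<n))
  ...   | inj₂ k≡n = ¬-not λ p → <-irrefl refl
          (≤-trans (core-deg N _ S x p) (≤-trans (count≤n _) (≤-reflexive (sym k≡n))))

  maxK-unique : ∀ k S x → core N k S x ≡ true → (∀ y → core N (suc k) S y ≡ false) → maxK N S ≡ k
  maxK-unique k S x p above = maxKFrom-unique n S k
    ( ≤-trans (core-deg N k S x p) (count≤n _)
    , inj₂ (nonempty-intro _ x p)
    , λ j k<j _ → nonempty-false _ λ y → ¬-not λ q →
        true≢false (trans (sym (core-mono N N (λ _ _ e → e) k<j (λ _ e → e) y q)) (above y)))

module _ {n : ℕ} {a : Fin n → Fin n → Bool} where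

  reach-start : ∀ {S x y} → ReachIn a S x y → S x ≡ true
  reach-start (here p)     = p
  reach-start (step q _ _) = reach-start q

  reach-end : ∀ {S x y} → ReachIn a S x y → S y ≡ true
  reach-end (here p)     = p
  reach-end (step _ _ p) = p

  reach-trans : ∀ {S x y z} → ReachIn a S x y → ReachIn a S y z → ReachIn a S x z
  reach-trans p (here _)     = p
  reach-trans p (step q e s) = step (reach-trans p q) e s

reach-mono : ∀ {n} {a a' : Fin n → Fin n → Bool} {S S'} → S ⊆ S' →
             (∀ u v → a u v ≡ true → a' u v ≡ true) →
             ∀ {x y} → ReachIn a S x y → ReachIn a' S' x y
reach-mono S⊆S' a⊆a' (here p)     = here (S⊆S' _ p)
reach-mono S⊆S' a⊆a' (step q e s) = step (reach-mono S⊆S' a⊆a' q) (a⊆a' _ _ e) (S⊆S' _ s)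

module _ {n : ℕ} (N : Network n) where

  coreAt-⊆ : ∀ r → coreAt N r ⊆ remaining N r
  coreAt-⊆ r = core-⊆ N (maxK N (remaining N r)) (remaining N r)

  remaining-antitone : ∀ {r r'} → r ≤ r' → remaining N r' ⊆ remaining N r
  remaining-antitone {r} {r'} r≤r' x = go (r' ∸ r) ∘ subst (λ i → remaining N i x ≡ true) (sym (m∸n+n≡m r≤r'))
    where
    go : ∀ d → remaining N (d + r) x ≡ true → remaining N r x ≡ true
    go zero    p = p
    go (suc d) p = go d (∧-trueˡ (remaining N (d + r) x) p)

  remaining-⊆-V : ∀ r → remaining N r ⊆ V N
  remaining-⊆-V r = remaining-antitone {0} {r} z≤n

  coreAt-removed : ∀ r x → coreAt N r x ≡ true → remaining N (suc r) x ≡ false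
  coreAt-removed r x p rewrite p = ∧-zeroʳ (remaining N r x)

  coreAt-disjoint : ∀ {r r' x} → coreAt N r x ≡ true → coreAt N r' x ≡ true → r ≡ r'
  coreAt-disjoint {r} {r'} {x} p p' with <-cmp r r'
  ... | tri≈ _ r≡r' _ = r≡r'
  ... | tri< r<r' _ _ = ⊥-elim (true≢false (trans (sym (remaining-antitone r<r' x (coreAt-⊆ r' x p')))
                                                 (coreAt-removed r x p)))
  ... | tri> _ _ r>r' = ⊥-elim (true≢false (trans (sym (remaining-antitone r>r' x (coreAt-⊆ r x p)))
                                                 (coreAt-removed r' x p')))

  remaining-emptied : ∀ r → (∀ x → remaining N r x ≡ false) → ∀ x → remaining N (suc r) x ≡ false
  remaining-emptied r empty x rewrite empty x = refl

  remaining-shrinks : ∀ r → (∀ x → remaining N r x ≡ false) ⊎ count (remaining N r) + r ≤ n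
  remaining-shrinks zero = inj₂ (≤-trans (≤-reflexive (+-identityʳ _)) (count≤n _))
  remaining-shrinks (suc r) with remaining-shrinks r
  ... | inj₁ empty = inj₁ (remaining-emptied r empty)
  ... | inj₂ small with search (remaining N r)
  ...   | inj₂ empty   = inj₁ (remaining-emptied r empty)
  ...   | inj₁ (x , p) =
    let y , q = roundCore-nonempty N (remaining N r) x p in
    inj₂ (≤-trans (≤-reflexive (+-suc _ r))
           (≤-trans (+-monoˡ-≤ r (count-strict (λ z s → ∧-trueˡ (remaining N r z) s) y
                                               (coreAt-⊆ r y q) (coreAt-removed r y q)))
                    small))

  remaining-exhausted : ∀ x → remaining N n x ≡ false
  remaining-exhausted with remaining-shrinks n
  ... | inj₁ empty = empty
  ... | inj₂ small = count≡0⇒empty (n≤0⇒n≡0 (+-cancelʳ-≤ _ _ 0 small))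

  removed-earlier : ∀ j x → V N x ≡ true → remaining N j x ≡ false → ∃ λ r → r < j × coreAt N r x ≡ true
  removed-earlier zero    x v p = ⊥-elim (true≢false (trans (sym v) p))
  removed-earlier (suc j) x v p with remaining N j x in q
  ... | false = let r , r<j , c = removed-earlier j x v q in r , m<n⇒m<1+n r<j , c
  ... | true  = j , ≤-refl , in-core (coreAt N j x) p
    where
    in-core : ∀ b → true ∧ not b ≡ false → b ≡ true
    in-core true _ = refl

  round-of : ∀ x → V N x ≡ true → ∃ λ r → coreAt N r x ≡ true
  round-of x v = let r , _ , c = removed-earlier n x v (remaining-exhausted x) in r , c

IKC-via-remaining : ∀ {n} (N : Network n) r {S} → remaining N r ≐ S →
                    ∀ {x y} → ReachIn (adj N) (roundCore N S) x y → IKC N x y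
IKC-via-remaining N r R≐S p = r , reach-mono (≐⇒⊆ (roundCore-cong N (sym ∘ R≐S))) (λ _ _ e → e) p

IKC-when-V-is-top-core : ∀ {n} (N : Network n) k → (∀ x → V N x ≡ true → k ≤ deg N (V N) x) →
            (∀ x → core N (suc k) (V N) x ≡ false) →
            ∀ {x y} → ReachIn (adj N) (V N) x y → IKC N x y
IKC-when-V-is-top-core N k V-deg above p = 0 , reach-mono V⊆round₀ (λ _ _ e → e) p
  where
  V⊆core : V N ⊆ core N k (V N)
  V⊆core = core-maximal N k (λ _ v → v) V-deg
  V⊆round₀ : V N ⊆ coreAt N 0
  V⊆round₀ x v rewrite maxK-unique N k (V N) x (V⊆core x v) above = V⊆core x v

-- Restriction to a union of clusters

-- K ∩ R' keeps minimum degree k in N', while every core of N' on R' lies in the same core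
-- of N on R; hence the top core of N' on R' is K ∩ R', at the same level k.
roundCore-restrict : ∀ {n} (N N' : Network n) → N' ⊆ᴱ N → ∀ (R R' : Set⟨ n ⟩) → R' ⊆ R →
  (∀ x w → roundCore N R x ≡ true → R' x ≡ true → roundCore N R w ≡ true → adj N x w ≡ true →
     R' w ≡ true × adj N' x w ≡ true) →
  ∀ x₀ → roundCore N R x₀ ∧ R' x₀ ≡ true →
  roundCore N' R' ≐ (λ x → roundCore N R x ∧ R' x)
roundCore-restrict N N' N'⊆N R R' R'⊆R edges-kept x₀ x₀∈T =
  subst (λ j → core N' j R' ≐ T) (sym maxK'≡k) (⊆-antisym core'⊆T T⊆core')
  where
  k = maxK N R
  K = core N k R
  T : Set⟨ _ ⟩
  T x = K x ∧ R' x

  T-deg : ∀ x → T x ≡ true → k ≤ deg N' T x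
  T-deg x t = ≤-trans (core-deg N k R x Kx) (count-mono λ w p →
    let Kw = ∧-trueˡ (K w) p ; R'w , e' = edges-kept x w Kx (∧-trueʳ (K x) t) Kw (∧-trueʳ (K w) p)
    in ∧-true (∧-true Kw R'w) e')
    where Kx = ∧-trueˡ (K x) t

  T⊆core' : T ⊆ core N' k R'
  T⊆core' = core-maximal N' k (λ x t → ∧-trueʳ (K x) t) T-deg

  core'⊆core : ∀ j → core N' j R' ⊆ core N j R
  core'⊆core j = core-mono N' N N'⊆N ≤-refl R'⊆R

  core'⊆T : core N' k R' ⊆ T
  core'⊆T x p = ∧-true (core'⊆core k x p) (core-⊆ N' k R' x p)

  maxK'≡k : maxK N' R' ≡ k
  maxK'≡k = maxK-unique N' k R' x₀ (T⊆core' x₀ x₀∈T) λ y → ¬-not λ p →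
    true≢false (trans (sym (core'⊆core (suc k) y p)) (core-above-maxK N R y))

module Restriction {n : ℕ} (N N' : Network n) (U : Set⟨ n ⟩)
  (V-restricted : ∀ x → V N' x ≡ V N x ∧ U x)
  (edges-⊆ : N' ⊆ᴱ N)
  (U-closed : ∀ x y → U x ≡ true → IKC N x y → U y ≡ true)
  (cluster-edges-kept : ∀ x y → U x ≡ true → IKC N x y → adj N x y ≡ true → adj N' x y ≡ true)
  where

  R = remaining N
  K = coreAt N
  R' = remaining N'
  K' = coreAt N'

  Aligned : ℕ → ℕ → Set
  Aligned r j = R' j ≐ (λ x → R r x ∧ U x)

  Aligned-edges : ∀ r j → Aligned r j → ∀ x w → K r x ≡ true → R' j x ≡ true →
                  K r w ≡ true → adj N x w ≡ true → R' j w ≡ true × adj N' x w ≡ true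
  Aligned-edges r j aligned x w Kx R'x Kw e =
    trans (aligned w) (∧-true (coreAt-⊆ N r w Kw) (U-closed x w Ux xw)) , cluster-edges-kept x w Ux xw e
    where
    Ux = ∧-trueʳ (R r x) (trans (sym (aligned x)) R'x)
    xw : IKC N x w
    xw = r , step (here Kx) e Kw

  Aligned-core : ∀ r j → Aligned r j → ∀ x₀ → K r x₀ ∧ R' j x₀ ≡ true →
                 K' j ≐ (λ x → K r x ∧ R' j x)
  Aligned-core r j aligned =
    roundCore-restrict N N' edges-⊆ (R r) (R' j)
      (λ x p → ∧-trueˡ (R r x) (trans (sym (aligned x)) p)) (Aligned-edges r j aligned)

  align : ∀ r → ∃ (Aligned r)
  align zero = zero , V-restricted
  align (suc r) with align r
  ... | j , aligned with search (λ x → K r x ∧ R' j x)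
  ...   | inj₁ (x₀ , p) = suc j , λ x →
          trans (cong₂ (λ a c → a ∧ not c) (aligned x)
                       (trans (Aligned-core r j aligned x₀ p x) (cong (K r x ∧_) (aligned x))))
                (remove-core (R r x) (K r x) (U x))
    where
    remove-core : ∀ a b c → (a ∧ c) ∧ not (b ∧ (a ∧ c)) ≡ (a ∧ not b) ∧ c
    remove-core true  true  c     = ∧-inverseʳ c
    remove-core true  false true  = refl
    remove-core true  false false = refl
    remove-core false b     c     = refl
  ...   | inj₂ disjoint = j , λ x →
          trans (aligned x) (skip (R r x) (K r x) (U x) (subst (λ c → K r x ∧ c ≡ false) (aligned x) (disjoint x)))
    where
    skip : ∀ a b c → b ∧ (a ∧ c) ≡ false → a ∧ c ≡ (a ∧ not b) ∧ c
    skip true  true  false _ = refl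
    skip true  false c     _ = refl
    skip false b     c     _ = refl

  restrict⇒ : ∀ {x y} → IKC N' x y → U x ≡ true × IKC N x y
  restrict⇒ {x} {y} (j , p') = Ux , r , reach-mono (λ w c → ∧-trueˡ (K r w) (trans (sym (K'≐ w)) c)) edges-⊆ p
    where
    K'x = reach-start p'
    VUx = trans (sym (V-restricted x)) (remaining-⊆-V N' j x (coreAt-⊆ N' j x K'x))
    Ux = ∧-trueʳ (V N x) VUx
    r = proj₁ (round-of N x (∧-trueˡ (V N x) VUx))
    Kx = proj₂ (round-of N x (∧-trueˡ (V N x) VUx))
    j₀ = proj₁ (align r)
    aligned = proj₂ (align r)
    R'x = trans (aligned x) (∧-true (coreAt-⊆ N r x Kx) Ux)
    K'≐ = Aligned-core r j₀ aligned x (∧-true Kx R'x)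
    p : ReachIn (adj N') (K' j₀) x y
    p = subst (λ i → ReachIn (adj N') (K' i) x y)
              (coreAt-disjoint N' {j} {j₀} {x} K'x (trans (K'≐ x) (∧-true Kx R'x))) p'

  restrict⇐ : ∀ {x y} → U x ≡ true → IKC N x y → IKC N' x y
  restrict⇐ {x} Ux (r , p) = proj₁ (align r) , lift p
    where
    aligned = proj₂ (align r)
    in-R' : ∀ {z} → ReachIn (adj N) (K r) x z → R' (proj₁ (align r)) z ≡ true
    in-R' q = trans (aligned _) (∧-true (coreAt-⊆ N r _ (reach-end q)) (U-closed x _ Ux (r , q)))
    K'≐ = Aligned-core r (proj₁ (align r)) aligned x (∧-true (reach-start p) (in-R' (here (reach-start p))))
    lift : ∀ {z} → ReachIn (adj N) (K r) x z → ReachIn (adj N') (K' (proj₁ (align r))) x z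
    lift q@(here Kx) = here (trans (K'≐ x) (∧-true Kx (in-R' q)))
    lift q@(step {y'} q' e Kz) =
      step (lift q')
           (cluster-edges-kept y' _ (U-closed x y' Ux (r , q')) (r , step (here (reach-end q')) e Kz) e)
           (trans (K'≐ _) (∧-true Kz (in-R' q)))

  restrict : ∀ x y → IKC N' x y ⇔ (U x ≡ true × IKC N x y)
  restrict x y = mk⇔ restrict⇒ (λ (Ux , xy) → restrict⇐ Ux xy)

interEdgeConsistency : InterEdgeConsistency IKC
interEdgeConsistency N N' (same-V , edges-⊆ , deleted-inter) x y =
  mk⇔ (proj₂ ∘ restrict⇒) (restrict⇐ refl)
  where
  kept : ∀ x y → true ≡ true → IKC N x y → adj N x y ≡ true → adj N' x y ≡ true
  kept x y _ xy e = ¬-not λ e' → deleted-inter x y e e' xy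
  open Restriction N N' (λ _ → true) (λ x → trans (same-V x) (sym (∧-identityʳ (V N x))))
                   edges-⊆ (λ _ _ _ _ → refl) kept

fixedPoint : FixedPoint IKC
fixedPoint N U U⊆V _ U-closed = Restriction.restrict N (induced N U) U V-restricted
  (λ x y e → ∧-trueˡ (adj N x y) e) U-closed
  (λ x y Ux xy e → ∧-true e (∧-true Ux (U-closed x y Ux xy)))
  where
  V-restricted : ∀ x → U x ≡ V N x ∧ U x
  V-restricted x with U x in p
  ... | true  = sym (trans (cong (_∧ true) (U⊆V x p)) refl)
  ... | false = sym (∧-zeroʳ (V N x))

-- Richness

module LabelCliques {n : ℕ} (W : Set⟨ n ⟩) (label : Fin n → ℕ) where

  sameLabel : Fin n → Fin n → Bool
  sameLabel x y = label x ≡ᵇ label y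

  adjacency : Fin n → Fin n → Bool
  adjacency x y = W x ∧ W y ∧ sameLabel x y ∧ not (x == y)

  network : Network n
  network = record
    { V = W ; adj = adjacency ; symm = symm′ ; loopless = loopless′ ; inV = λ x y e → ∧-trueˡ (W x) e }
    where
    symm′ : ∀ x y → adjacency x y ≡ adjacency y x
    symm′ x y rewrite ≡ᵇ-sym (label x) (label y) | ==-sym x y = swap (W x) (W y)
      where
      swap : ∀ a b {c} → a ∧ b ∧ c ≡ b ∧ a ∧ c
      swap true  b = refl
      swap false b = sym (∧-zeroʳ b)
    loopless′ : ∀ x → adjacency x x ≡ false
    loopless′ x rewrite ==-refl x | ∧-zeroʳ (sameLabel x x) | ∧-zeroʳ (W x) = ∧-zeroʳ (W x)

  R = remaining network
  K = coreAt network

  sameLabel⇒≡ : ∀ {x y} → sameLabel x y ≡ true → label x ≡ label y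
  sameLabel⇒≡ = ≡ᵇ≡true⇒≡

  edge⇒sameLabel : ∀ {x y} → adjacency x y ≡ true → label x ≡ label y
  edge⇒sameLabel {x} {y} e = sameLabel⇒≡ (∧-trueˡ (sameLabel x y) (∧-trueʳ (W y) (∧-trueʳ (W x) e)))

  class : ℕ → Fin n → Set⟨ n ⟩
  class r y v = R r v ∧ sameLabel v y

  core-nbrs⊆class : ∀ r y → deg network (K r) y ≤ count (λ v → class r y v ∧ not (v == y))
  core-nbrs⊆class r y = count-mono λ v p →
    let Kv = ∧-trueˡ (K r v) p ; e = ∧-trueʳ (K r v) p in
    ∧-true (∧-true (coreAt-⊆ network r v Kv) (≡⇒≡ᵇ≡true (sym (edge⇒sameLabel e))))
           (trans (cong not (==-sym v y)) (∧-trueʳ (sameLabel y v) (∧-trueʳ (W v) (∧-trueʳ (W y) e))))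

  class⊆nbrs : ∀ r y {T} → class r y ⊆ T → ∀ w → class r y w ≡ true →
               count (λ v → class r y v ∧ not (v == w)) ≤ deg network T w
  class⊆nbrs r y class⊆T w Cw = count-mono λ v p →
    let Cv = ∧-trueˡ (class r y v) p
        Rw = ∧-trueˡ (R r w) Cw ; Rv = ∧-trueˡ (R r v) Cv
        w~v = trans (sameLabel⇒≡ (∧-trueʳ (R r w) Cw)) (sym (sameLabel⇒≡ (∧-trueʳ (R r v) Cv)))
    in ∧-true (class⊆T v Cv)
         (∧-true (remaining-⊆-V network r w Rw) (∧-true (remaining-⊆-V network r v Rv)
           (∧-true (≡⇒≡ᵇ≡true w~v) (trans (cong not (==-sym w v)) (∧-trueʳ (class r y v) p)))))

  -- Every member w of the label class of a core vertex y has deg w ≥ |class| - 1 ≥ deg y ≥ k,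
  -- so the class can be added to the core.
  label-class-in-core : ∀ r {x y} → K r y ≡ true → R r x ≡ true → label x ≡ label y → K r x ≡ true
  label-class-in-core r {x} {y} Ky Rx x~y =
    core-maximal network k T⊆R T-deg x (∨-trueʳ (K r x) (∧-true Rx (≡⇒≡ᵇ≡true x~y)))
    where
    k = maxK network (R r)
    T : Set⟨ n ⟩
    T v = K r v ∨ class r y v
    T⊆R : T ⊆ R r
    T⊆R v t with ∨-true (K r v) t
    ... | inj₁ Kv = coreAt-⊆ network r v Kv
    ... | inj₂ Cv = ∧-trueˡ (R r v) Cv
    class-size : ∀ w → class r y w ≡ true → suc (count (λ v → class r y v ∧ not (v == w))) ≡ count (class r y)
    class-size = count-remove (class r y)
    Cy : class r y y ≡ true
    Cy = ∧-true (coreAt-⊆ network r y Ky) (≡⇒≡ᵇ≡true {label y} refl)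
    T-deg : ∀ w → T w ≡ true → k ≤ deg network T w
    T-deg w t with ∨-true (K r w) t
    ... | inj₁ Kw = ≤-trans (core-deg network k (R r) w Kw)
                            (deg-mono network network (λ _ _ e → e) (λ v p → ∨-trueˡ {K r v} {class r y v} p) w)
    ... | inj₂ Cw = ≤-trans (core-deg network k (R r) y Ky) (≤-trans (core-nbrs⊆class r y)
                      (≤-trans (≤-reflexive (suc-injective (trans (class-size y Cy) (sym (class-size w Cw)))))
                               (class⊆nbrs r y (λ v → ∨-trueʳ (K r v)) w Cw)))

  IKC⇒sameLabel : ∀ x y → IKC network x y → W x ≡ true × W y ≡ true × label x ≡ label y
  IKC⇒sameLabel x y (r , p) = in-W (reach-start p) , go p
    where
    in-W : ∀ {z} → K r z ≡ true → W z ≡ true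
    in-W c = remaining-⊆-V network r _ (coreAt-⊆ network r _ c)
    go : ∀ {z} → ReachIn adjacency (K r) x z → W z ≡ true × label x ≡ label z
    go (here c)     = in-W c , refl
    go (step q e c) = in-W c , trans (proj₂ (go q)) (edge⇒sameLabel e)

  sameLabel⇒IKC : ∀ x y → W x ≡ true × W y ≡ true × label x ≡ label y → IKC network x y
  sameLabel⇒IKC x y (Wx , Wy , x~y) = r , path
    where
    r = proj₁ (round-of network x Wx)
    Kx = proj₂ (round-of network x Wx)
    Ky : K r y ≡ true
    Ky with R r y in Ry
    ... | true  = label-class-in-core r Kx Ry (sym x~y)
    ... | false with removed-earlier network r y Wy Ry
    ...   | r' , r'<r , Ky' = ⊥-elim (<-irrefl (coreAt-disjoint network {r'} {r} {x} Kx' Kx) r'<r)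
      where
      Kx' = label-class-in-core r' Ky' (remaining-antitone network (<⇒≤ r'<r) x (coreAt-⊆ network r x Kx)) x~y
    path : ReachIn adjacency (K r) x y
    path with x == y in x=y
    ... | true  = subst (ReachIn adjacency (K r) x) (==⇒≡ x=y) (here Kx)
    ... | false = step (here Kx) (∧-true Wx (∧-true Wy (∧-true (≡⇒≡ᵇ≡true x~y) (cong not x=y)))) Ky

richness : Richness IKC
richness n W label = network , (λ _ → refl) , λ x y → mk⇔ (IKC⇒sameLabel x y) (sameLabel⇒IKC x y)
  where open LabelCliques W label

link : ∀ {n} → Fin n → Fin n → Fin n → Fin n → Bool
link u v x y = (x == u ∧ y == v) ∨ (x == v ∧ y == u)

link-sym : ∀ {n} (u v x y : Fin n) → link u v x y ≡ link u v y x
link-sym u v x y =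
  trans (∨-comm (x == u ∧ y == v) _) (cong₂ _∨_ (∧-comm (x == v) (y == u)) (∧-comm (x == u) (y == v)))

link-inv : ∀ {n} {u v x y : Fin n} → link u v x y ≡ true → (x ≡ u × y ≡ v) ⊎ (x ≡ v × y ≡ u)
link-inv {u = u} {v} {x} {y} e with ∨-true (x == u ∧ y == v) e
... | inj₁ p = inj₁ (==⇒≡ (∧-trueˡ (x == u) p) , ==⇒≡ (∧-trueʳ (x == u) p))
... | inj₂ p = inj₂ (==⇒≡ (∧-trueˡ (x == v) p) , ==⇒≡ (∧-trueʳ (x == v) p))

link-self : ∀ {n} (u v : Fin n) → link u v u v ≡ true
link-self u v rewrite ==-refl u | ==-refl v = refl

deleteEdge : ∀ {n} → Network n → Fin n → Fin n → Network n
deleteEdge N u v = record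
  { V = V N
  ; adj = λ x y → adj N x y ∧ not (link u v x y)
  ; symm = λ x y → cong₂ (λ e l → e ∧ not l) (symm N x y) (link-sym u v x y)
  ; loopless = λ x → cong (_∧ _) (loopless N x)
  ; inV = λ x y e → inV N x y (∧-trueˡ (adj N x y) e)
  }

AtMostOneEdge : ∀ {n} → (Fin n → Fin n → Bool) → Set
AtMostOneEdge F = ∀ x y x' y' → toℕ x < toℕ y → toℕ x' < toℕ y' →
                  F x y ≡ true → F x' y' ≡ true → x ≡ x' × y ≡ y'

edgeCount-≡0 : ∀ {n} (F : Fin n → Fin n → Bool) → (∀ x y → toℕ x < toℕ y → F x y ≡ false) →
               edgeCount F ≡ 0
edgeCount-≡0 {zero}  F _    = refl
edgeCount-≡0 {suc n} F none =
  cong₂ _+_ (count-≡0 first) (edgeCount-≡0 (λ x y → F (fsuc x) (fsuc y)) (λ x y x<y → none _ _ (s≤s x<y)))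
  where
  first : ∀ y → (0 <ᵇ toℕ y) ∧ F fzero y ≡ false
  first y with 0 <ᵇ toℕ y in p
  ... | false = refl
  ... | true  = none fzero y (<ᵇ≡true⇒< p)

edgeCount-≤1 : ∀ {n} (F : Fin n → Fin n → Bool) → AtMostOneEdge F → edgeCount F ≤ 1
edgeCount-≤1 {zero}  F _   = z≤n
edgeCount-≤1 {suc n} F one = [ edge-at-0 , no-edge-at-0 ]′ (search first)
  where
  first : Set⟨ suc n ⟩
  first y = (0 <ᵇ toℕ y) ∧ F fzero y
  rest : Fin n → Fin n → Bool
  rest x y = F (fsuc x) (fsuc y)
  positive : ∀ {y} → first y ≡ true → 0 < toℕ y
  positive {y} q = <ᵇ≡true⇒< (∧-trueˡ (0 <ᵇ toℕ y) q)

  edge-at-0 : (∃ λ y → first y ≡ true) → count first + edgeCount rest ≤ 1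
  edge-at-0 (y₀ , p) = subst (λ c → count first + c ≤ 1) (sym (edgeCount-≡0 rest no-later-edge))
                             (≤-trans (≤-reflexive (+-identityʳ _)) (count-≤1 first same-endpoint))
    where
    same-endpoint : ∀ y y' → first y ≡ true → first y' ≡ true → y ≡ y'
    same-endpoint y y' q q' = proj₂ (one _ _ _ _ (positive q) (positive q') (∧-trueʳ _ q) (∧-trueʳ _ q'))
    no-later-edge : ∀ x y → toℕ x < toℕ y → rest x y ≡ false
    no-later-edge x y x<y = ¬-not λ q →
      0≢1+n (sym (cong toℕ (proj₁ (one _ _ _ _ (s≤s x<y) (positive p) q (∧-trueʳ _ p)))))

  no-edge-at-0 : (∀ y → first y ≡ false) → count first + edgeCount rest ≤ 1
  no-edge-at-0 none = subst (λ c → c + edgeCount rest ≤ 1) (sym (count-≡0 none))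
    (edgeCount-≤1 rest λ x y x' y' x<y x'<y' q q' →
       let e , e' = one _ _ _ _ (s≤s x<y) (s≤s x'<y') q q' in fsuc-injective e , fsuc-injective e')

link-atMostOneEdge : ∀ {n} (u v : Fin n) → AtMostOneEdge (link u v)
link-atMostOneEdge u v x y x' y' x<y x'<y' e e'
  with link-inv {u = u} {v} {x} {y} e | link-inv {u = u} {v} {x'} {y'} e'
... | inj₁ (refl , refl) | inj₁ (refl , refl) = refl , refl
... | inj₂ (refl , refl) | inj₂ (refl , refl) = refl , refl
... | inj₁ (refl , refl) | inj₂ (refl , refl) = ⊥-elim (<-asym x<y x'<y')
... | inj₂ (refl , refl) | inj₁ (refl , refl) = ⊥-elim (<-asym x<y x'<y')

-- Two cliques joined by one edge

module TwoCliques (q : ℕ) where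

  size : ℕ
  size = suc q + suc q

  inA inB : Set⟨ size ⟩
  inA x = toℕ x <ᵇ suc q
  inB x = not (inA x)

  sameSide : Fin size → Fin size → Bool
  sameSide x y = (inA x ∧ inA y) ∨ (inB x ∧ inB y)

  a b : Fin size
  a = fromℕ q ↑ˡ suc q
  b = suc q ↑ʳ fzero

  adjacency : Fin size → Fin size → Bool
  adjacency x y = not (x == y) ∧ (sameSide x y ∨ link a b x y)

  network : Network size
  network = record
    { V = λ _ → true ; adj = adjacency ; symm = symm′
    ; loopless = λ x → cong (λ e → not e ∧ (sameSide x x ∨ link a b x x)) (==-refl x)
    ; inV = λ _ _ _ → refl }
    where
    symm′ : ∀ x y → adjacency x y ≡ adjacency y x
    symm′ x y = cong₂ (λ e s → not e ∧ s) (==-sym x y)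
                  (cong₂ _∨_ (cong₂ _∨_ (∧-comm (inA x) (inA y)) (∧-comm (inB x) (inB y))) (link-sym a b x y))

  toℕ-a : toℕ a ≡ q
  toℕ-a = trans (toℕ-↑ˡ (fromℕ q) (suc q)) (toℕ-fromℕ q)

  toℕ-b : toℕ b ≡ suc q
  toℕ-b = trans (toℕ-↑ʳ (suc q) (fzero {q})) (+-identityʳ (suc q))

  a∈A : inA a ≡ true
  a∈A = subst (λ m → (m <ᵇ suc q) ≡ true) (sym toℕ-a) (<⇒<ᵇ≡true (n<1+n q))

  b∉A : inA b ≡ false
  b∉A = subst (λ m → (m <ᵇ suc q) ≡ false) (sym toℕ-b) (¬-not (<-irrefl refl ∘ <ᵇ≡true⇒< {suc q}))

  count-A : count inA ≡ suc q
  count-A = count-<ᵇ (suc q) (m≤m+n (suc q) (suc q))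

  count-B : count inB ≡ suc q
  count-B = +-cancelˡ-≡ (suc q) _ _ (trans (cong (_+ count inB) (sym count-A)) (count-+-count-not inA))

  sameSide-refl : ∀ x → sameSide x x ≡ true
  sameSide-refl x with inA x
  ... | true  = refl
  ... | false = refl

  count-sameSide : ∀ x → count (sameSide x) ≡ suc q
  count-sameSide x with inA x
  ... | true  = trans (count-cong (λ y → ∨-identityʳ (inA y))) count-A
  ... | false = count-B

  sameSide⇒adjacent : ∀ x y → sameSide x y ≡ true → x ≢ y → adjacency x y ≡ true
  sameSide⇒adjacent x y s x≢y rewrite ≢⇒==-false x≢y | s = refl

  adjacent⇒≢ : ∀ {x y} → adjacency x y ≡ true → x ≢ y
  adjacent⇒≢ {x} e refl = true≢false (trans (sym e) (loopless network x))

  cross-edge : ∀ x y → inA x ≡ true → inA y ≡ false → adjacency x y ≡ true → x ≡ a × y ≡ b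
  cross-edge x y x∈A y∉A e with link-inv {u = a} {b} {x} {y} (bridge (∧-trueʳ (not (x == y)) e))
    where
    bridge : sameSide x y ∨ link a b x y ≡ true → link a b x y ≡ true
    bridge rewrite x∈A | y∉A = λ l → l
  ... | inj₁ x≡a,y≡b = x≡a,y≡b
  ... | inj₂ (refl , _) = ⊥-elim (true≢false (trans (sym x∈A) b∉A))

  a-b-adjacent : adjacency a b ≡ true
  a-b-adjacent = ∧-true (cong not (≢⇒==-false a≢b)) (∨-trueʳ (sameSide a b) (link-self a b))
    where
    a≢b : a ≢ b
    a≢b a≡b = true≢false (trans (sym a∈A) (trans (cong inA a≡b) b∉A))

  full : Set⟨ size ⟩
  full _ = true

  count-side-minus : ∀ x → count (λ y → sameSide x y ∧ not (y == x)) ≡ q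
  count-side-minus x = suc-injective (trans (count-remove (sameSide x) x (sameSide-refl x)) (count-sameSide x))

  deg-≥ : ∀ x → q ≤ deg network full x
  deg-≥ x = subst (_≤ deg network full x) (count-side-minus x)
    (count-mono λ y p → sameSide⇒adjacent x y (∧-trueˡ (sameSide x y) p)
                          (λ x≡y → not-==⇒≢ (∧-trueʳ (sameSide x y) p) (sym x≡y)))

  deg-≤ : ∀ x → x ≢ a → x ≢ b → deg network full x ≤ q
  deg-≤ x x≢a x≢b = subst (deg network full x ≤_) (count-side-minus x)
    (count-mono λ y e → ∧-true (same-side y e) (trans (cong not (==-sym y x)) (∧-trueˡ (not (x == y)) e)))
    where
    same-side : ∀ y → adjacency x y ≡ true → sameSide x y ≡ true
    same-side y e with ∨-true (sameSide x y) (∧-trueʳ (not (x == y)) e)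
    ... | inj₁ s = s
    ... | inj₂ l with link-inv {u = a} {b} {x} {y} l
    ...   | inj₁ (x≡a , _) = ⊥-elim (x≢a x≡a)
    ...   | inj₂ (x≡b , _) = ⊥-elim (x≢b x≡b)

  -- Only the two bridge ends have degree q + 1, and they have just one edge between them.
  core-above-q-empty : 1 ≤ q → ∀ x → core network (suc q) full x ≡ false
  core-above-q-empty 1≤q x = ¬-not λ c → <-irrefl refl
    (≤-trans (s≤s 1≤q) (≤-trans (core-deg network (suc q) full x c) (C-deg≤1 x c)))
    where
    C = core network (suc q) full
    C⊆ends : ∀ x → C x ≡ true → x ≡ a ⊎ x ≡ b
    C⊆ends x c with x ≟ a | x ≟ b
    ... | yes x≡a | _       = inj₁ x≡a
    ... | no _    | yes x≡b = inj₂ x≡b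
    ... | no x≢a  | no x≢b  = ⊥-elim (<-irrefl refl (≤-trans (core-deg network (suc q) full x c)
          (≤-trans (deg-mono network network {S' = C} (λ _ _ e → e) (λ _ _ → refl) x) (deg-≤ x x≢a x≢b))))
    other-end : ∀ {x y y'} → x ≡ a ⊎ x ≡ b → y ≡ a ⊎ y ≡ b → y' ≡ a ⊎ y' ≡ b → x ≢ y → x ≢ y' → y ≡ y'
    other-end _           (inj₁ refl) (inj₁ refl) _   _    = refl
    other-end _           (inj₂ refl) (inj₂ refl) _   _    = refl
    other-end (inj₁ refl) (inj₁ refl) (inj₂ refl) x≢y _    = ⊥-elim (x≢y refl)
    other-end (inj₂ refl) (inj₁ refl) (inj₂ refl) _   x≢y' = ⊥-elim (x≢y' refl)
    other-end (inj₁ refl) (inj₂ refl) (inj₁ refl) _   x≢y' = ⊥-elim (x≢y' refl)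
    other-end (inj₂ refl) (inj₂ refl) (inj₁ refl) x≢y _    = ⊥-elim (x≢y refl)
    C-deg≤1 : ∀ x → C x ≡ true → deg network C x ≤ 1
    C-deg≤1 x c = count-≤1 _ λ y y' p p' →
      other-end (C⊆ends x c) (C⊆ends y (∧-trueˡ (C y) p)) (C⊆ends y' (∧-trueˡ (C y') p'))
                (adjacent⇒≢ (∧-trueʳ (C y) p)) (adjacent⇒≢ (∧-trueʳ (C y') p'))

  sameSide-intro : ∀ x y → inA x ≡ inA y → sameSide x y ≡ true
  sameSide-intro x y A≡A = subst (λ c → (c ∧ inA y) ∨ (not c ∧ inB y) ≡ true) (sym A≡A) (sameSide-refl y)

  sameSide-path : ∀ x y → inA x ≡ inA y → ReachIn adjacency full x y
  sameSide-path x y A≡A with x ≟ y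
  ... | yes refl = here refl
  ... | no x≢y   = step (here refl) (sameSide⇒adjacent x y (sameSide-intro x y A≡A) x≢y) refl

  connected : ∀ x y → ReachIn adjacency full x y
  connected x y with inA x in x∈ | inA y in y∈
  ... | true  | true  = sameSide-path x y (trans x∈ (sym y∈))
  ... | false | false = sameSide-path x y (trans x∈ (sym y∈))
  ... | true  | false = reach-trans (sameSide-path x a (trans x∈ (sym a∈A)))
                          (reach-trans (step (here refl) a-b-adjacent refl)
                                       (sameSide-path b y (trans b∉A (sym y∈))))
  ... | false | true  = reach-trans (sameSide-path x b (trans x∈ (sym b∉A)))
                          (reach-trans (step (here refl) (trans (symm network b a) a-b-adjacent) refl)
                                       (sameSide-path a y (trans a∈A (sym y∈))))

  single-cluster : 1 ≤ q → ∀ x y → IKC network x y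
  single-cluster 1≤q x y =
    IKC-when-V-is-top-core network q (λ x _ → deg-≥ x) (core-above-q-empty 1≤q) (connected x y)

  pairOfCliques : PairOfCliquesComponent network inA inB
  pairOfCliques =
    component , (λ x → ∧-inverseʳ (inA x)) , trans count-A (sym count-B) ,
    (λ x y x∈ y∈ → sameSide⇒adjacent x y (sameSide-intro x y (trans x∈ (sym y∈)))) ,
    (λ x y x∈ y∈ → sameSide⇒adjacent x y (sameSide-intro x y (not-injective (trans x∈ (sym y∈))))) ,
    a , b , a∈A , cong not b∉A , a-b-adjacent ,
    λ x y x∈ y∈ e → cross-edge x y x∈ (not-injective y∈) e
    where
    component : IsComponent network (λ x → inA x ∨ inB x)
    component = (λ _ _ → refl) , (fzero , ∨-inverseʳ (inA fzero)) , (λ _ y _ _ → ∨-inverseʳ (inA y)) ,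
                λ x y _ _ → reach-mono (λ z _ → ∨-inverseʳ (inA z)) (λ _ _ e → e) (connected x y)

  -- With A ∪ B a single cluster, A is not one; so any threshold of the axiom exceeds 2(q + 1).
  pairOfCliques-threshold : 1 ≤ q → (P : PairOfCliques IKC) → size < proj₁ P
  pairOfCliques-threshold 1≤q (n₀ , P) = ≰⇒> λ n₀≤size →
    let x , _ , A⇔ = proj₁ (P network inA inB pairOfCliques
                              (subst (n₀ ≤_) (sym (cong₂ _+_ count-A count-B)) n₀≤size))
    in true≢false (trans (sym (Equivalence.from (A⇔ b) (single-cluster 1≤q x b))) b∉A)

  link⇒adjacent : ∀ x y → link a b x y ≡ true → adjacency x y ≡ true
  link⇒adjacent x y l with link-inv {u = a} {b} {x} {y} l
  ... | inj₁ (refl , refl) = a-b-adjacent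
  ... | inj₂ (refl , refl) = trans (symm network b a) a-b-adjacent

  bridge-disconnects : DisconnectingSet network full (link a b)
  bridge-disconnects = link-sym a b , (λ x y l → link⇒adjacent x y l , refl , refl) ,
                       a , b , refl , refl , λ p → true≢false (trans (sym (stays-in-A p)) b∉A)
    where
    stays-in-A : ∀ {z} → ReachIn (λ u v → adjacency u v ∧ not (link a b u v)) full a z → inA z ≡ true
    stays-in-A (here _) = a∈A
    stays-in-A (step {y} {z} p e _) with inA z ≟ᵇ true
    ... | yes z∈ = z∈
    ... | no z∉ with cross-edge y z (stays-in-A p) (¬-not z∉) (∧-trueˡ (adjacency y z) e)
    ...   | refl , refl = ⊥-elim (true≢false (trans (sym (∧-trueʳ (adjacency a b) e)) (cong not (link-self a b))))

  -- Removing one edge disconnects the single cluster, whose size exceeds q; so f q < 1.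
  connectivity-bound : 1 ≤ q → (C : Connectivity IKC) → proj₁ C q ≡ 0
  connectivity-bound 1≤q (f , f-mono , _ , cut) = n<1⇒n≡0
    (≤-<-trans (f-mono q (count full) (≤-trans (n≤1+n q) (≤-trans (m≤m+n (suc q) (suc q)) size≤)))
      (<-≤-trans (cut network fzero full refl (λ y → mk⇔ (λ _ → single-cluster 1≤q fzero y) (λ _ → refl))
                      (≤-trans (+-mono-≤ (s≤s z≤n) (s≤s z≤n)) size≤) (link a b) bridge-disconnects)
                 (edgeCount-≤1 (link a b) (link-atMostOneEdge a b))))
    where
    size≤ : size ≤ count full
    size≤ = ≤-reflexive (sym (count-full {size}))

module Counterexample where

  -- Two triangles {0,1,2} and {3,4,5} joined by the edge 2–3, with the edge 3–5 removed:
  -- IKC first takes the triangle {0,1,2} as its 2-core and then the path 3–4–5.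
  -- Names are qualified and implicits given explicitly because unifying against an alias or a
  -- meta makes Agda unfold the IKC rounds symbolically, which does not terminate in practice.
  before : Network 6
  before = deleteEdge (TwoCliques.network 2) (# 3) (# 5)

  remaining₁ : remaining before 1 ≐ TwoCliques.inB 2
  remaining₁ = toWitness {a? = all? λ x → remaining before 1 x ≟ᵇ TwoCliques.inB 2 x} _

  path₃₅ : ReachIn (adj before) (roundCore before (TwoCliques.inB 2)) (# 3) (# 5)
  path₃₅ = step {y = # 4} (step {y = # 3} (here refl) refl refl) refl refl

  path₅₃ : ReachIn (adj before) (roundCore before (TwoCliques.inB 2)) (# 5) (# 3)
  path₅₃ = step {y = # 4} (step {y = # 5} (here refl) refl refl) refl refl

  linked⇒IKC : ∀ {x y} → (x ≡ # 3 × y ≡ # 5) ⊎ (x ≡ # 5 × y ≡ # 3) → IKC before x y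
  linked⇒IKC (inj₁ (refl , refl)) = IKC-via-remaining before 1 {S = TwoCliques.inB 2} remaining₁ path₃₅
  linked⇒IKC (inj₂ (refl , refl)) = IKC-via-remaining before 1 {S = TwoCliques.inB 2} remaining₁ path₅₃

  5∉first-round : coreAt before 0 (# 5) ≡ false
  5∉first-round = refl

  0-removed-first : remaining before 1 (# 0) ≡ false
  0-removed-first = refl

  0≁5 : ¬ IKC before (# 0) (# 5)
  0≁5 (zero  , p) = true≢false (trans (sym (reach-end p)) 5∉first-round)
  0≁5 (suc r , p) = true≢false (trans (sym (remaining-antitone before {1} {suc r} (s≤s z≤n) (# 0)
                                  (coreAt-⊆ before (suc r) (# 0) (reach-start p)))) 0-removed-first)

  change : ConsistentChange IKC before (TwoCliques.network 2)
  change = (λ _ → refl) , nothing-deleted ,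
           λ x y e e' → linked⇒IKC (link-inv {u = # 3} {# 5} {x} {y} (added x y e e'))
    where
    nothing-deleted : ∀ x y → adj before x y ≡ true → adj (TwoCliques.network 2) x y ≡ false → ¬ IKC before x y
    nothing-deleted x y e e' _ =
      true≢false (trans (sym (∧-trueˡ (adj (TwoCliques.network 2) x y) {not (link (# 3) (# 5) x y)} e)) e')
    added : ∀ x y → adj before x y ≡ false → adj (TwoCliques.network 2) x y ≡ true → link (# 3) (# 5) x y ≡ true
    added x y e e' = lemma (adj (TwoCliques.network 2) x y) {link (# 3) (# 5) x y} e' e
      where
      lemma : ∀ a {l} → a ≡ true → a ∧ not l ≡ false → l ≡ true
      lemma true {true} _ _ = refl

  0~5-after : IKC (TwoCliques.network 2) (# 0) (# 5)
  0~5-after = TwoCliques.single-cluster 2 (s≤s z≤n) (# 0) (# 5)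

¬standardConsistency : ¬ StandardConsistency IKC
¬standardConsistency sc = 0≁5 (Equivalence.to (sc before (TwoCliques.network 2) change (# 0) (# 5)) 0~5-after)
  where open Counterexample

¬refinementConsistency : ¬ RefinementConsistency IKC
¬refinementConsistency rc = 0≁5 (rc before (TwoCliques.network 2) change (# 0) (# 5) 0~5-after)
  where open Counterexample

¬pairOfCliques : ¬ PairOfCliques IKC
¬pairOfCliques P = <-irrefl refl (<-≤-trans (TwoCliques.pairOfCliques-threshold (suc n₀) (s≤s z≤n) P)
                                             (≤-trans (n≤1+n n₀) (≤-trans (n≤1+n (suc n₀)) (m≤m+n _ _))))
  where n₀ = proj₁ P

¬connectivity : ¬ Connectivity IKC
¬connectivity C@(f , f-mono , f-unbounded , _) =
  let m , 1≤f[m] = f-unbounded 1 in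
  n≮0 (subst (1 ≤_) (TwoCliques.connectivity-bound (suc m) (s≤s z≤n) C)
             (≤-trans 1≤f[m] (f-mono m (suc m) (n≤1+n m))))

theorem6 : Richness IKC × InterEdgeConsistency IKC × FixedPoint IKC ×
           ¬ StandardConsistency IKC × ¬ RefinementConsistency IKC ×
           ¬ Connectivity IKC × ¬ PairOfCliques IKC
theorem6 = richness , interEdgeConsistency , fixedPoint ,
           ¬standardConsistency , ¬refinementConsistency , ¬connectivity , ¬pairOfCliques
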